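{- Let $N\ge1$, $d\ge2$, $1\le k\le N$, and let $A$ be an irredundant orthogonal array IrOA$(d^k,N,d,k)$ (equivalently, a maximum distance separable code). Then the multiplicity vector of $A$ belongs to the Hilbert basis of the cone $C(N,d,k)$, i.e. the state associated to $A$ is a generating state.
   Context: An orthogonal array OA$(r,N,d,k)$ is an $r\times N$ array over $\{0,\dots,d-1\}$ such that in every $k$ columns every $k$-tuple of symbols appears the same number $\lambda=r/d^k$ of times (the index); it is irredundant if every subarray formed by $N-k$ columns has no repeated rows. IrOA$(d^k,N,d,k)$ denotes an irredundant one with $d^k$ runs (index one). The multiplicity vector of an array is $(c_x)_{x\in\{0,\dots,d-1\}^N}$ with $c_x$ the number of rows equal to $x$; the associated state is $\sum_x c_x|x_1\rangle\otimes\cdots\otimes|x_N\rangle$. The cone $C(N,d,k)\subset\mathbb R^{d^N}$ is the set of $(c_x)$ with $c_x\ge0$ and, for every set $S$ of $k$ coordinates and all $j,j'\in\{0,\dots,d-1\}^k$, $\sum_{x:x|_S=j}c_x=\sum_{x:x|_S=j'}c_x$. Its Hilbert basis is the unique minimal finite set of integer points of the cone such that every integer point of the cone is a nonnegative integer combination of them; states associated to Hilbert basis elements are called generating states. -}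

module Defs where

open import Data.Nat using (ℕ; zero; suc; _+_; _∸_; _^_)
open import Data.Fin using (Fin)
open import Data.Fin.Properties using () renaming (_≟_ to _≟ᶠ_)
open import Data.Vec using (Vec; []; _∷_; lookup; tabulate)
open import Data.Vec.Properties using (≡-dec)
open import Data.List using (List; []; _∷_; map; concatMap; filter; length; allFin)
open import Data.Nat.ListAction using (sum)
open import Data.Product using (Σ; proj₁; _×_)
open import Data.Sum using (_⊎_)
open import Function.Definitions using (Injective)
open import Relation.Binary.PropositionalEquality using (_≡_; _≢_)
open import Relation.Nullary using (¬_)

-- Points of {0,…,d-1}^N (index set of the coordinates of R^{d^N}).
Point : ℕ → ℕ → Set
Point N d = Vec (Fin d) N

_≟ᵖ_ : ∀ {N d} → (x y : Point N d) → Relation.Nullary.Dec (x ≡ y)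
_≟ᵖ_ = ≡-dec _≟ᶠ_

allPoints : (N d : ℕ) → List (Point N d)
allPoints zero    d = [] ∷ []
allPoints (suc N) d = concatMap (λ a → map (a ∷_) (allPoints N d)) (allFin d)

-- A set S of m columns among N, given as an injective listing Fin m → Fin N.
Columns : ℕ → ℕ → Set
Columns m N = Σ (Fin m → Fin N) (Injective _≡_ _≡_)

restrict : ∀ {m N d} → Point N d → Columns m N → Point m d
restrict x S = tabulate (λ i → lookup x (proj₁ S i))

Array : ℕ → ℕ → ℕ → Set
Array r N d = Fin r → Point N d

countRows : ∀ {r N d k} → Array r N d → Columns k N → Point k d → ℕ
countRows {r} A S j = length (filter (λ a → restrict (A a) S ≟ᵖ j) (allFin r))

IsOA : (r N d k : ℕ) → Array r N d → Set
IsOA r N d k A = (S : Columns k N) (j j' : Point k d) → countRows A S j ≡ countRows A S j'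

IsIrredundant : (r N d k : ℕ) → Array r N d → Set
IsIrredundant r N d k A =
  (T : Columns (N ∸ k) N) (a b : Fin r) → a ≢ b → restrict (A a) T ≢ restrict (A b) T

IsIrOA : (N d k : ℕ) → Array (d ^ k) N d → Set
IsIrOA N d k A = IsOA (d ^ k) N d k A × IsIrredundant (d ^ k) N d k A

IntVec : ℕ → ℕ → Set
IntVec N d = Point N d → ℕ

multiplicity : ∀ {r N d} → Array r N d → IntVec N d
multiplicity {r} A x = length (filter (λ a → A a ≟ᵖ x) (allFin r))

marginal : ∀ {N d k} → IntVec N d → Columns k N → Point k d → ℕ
marginal {N} {d} c S j = sum (map c (filter (λ x → restrict x S ≟ᵖ j) (allPoints N d)))

-- integer points of the cone C(N,d,k) (nonnegativity is built into ℕ)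
InCone : (N d k : ℕ) → IntVec N d → Set
InCone N d k c = (S : Columns k N) (j j' : Point k d) → marginal c S j ≡ marginal c S j'

IsZero : ∀ {N d} → IntVec N d → Set
IsZero c = ∀ x → c x ≡ 0

-- Hilbert basis membership of the (pointed) cone C(N,d,k): the nonzero integer
-- points of the cone that are not the sum of two nonzero integer points of the cone.
InHilbertBasis : (N d k : ℕ) → IntVec N d → Set
InHilbertBasis N d k c =
  InCone N d k c × ¬ IsZero c ×
  ((a b : IntVec N d) → InCone N d k a → InCone N d k b →
     (∀ x → c x ≡ a x + b x) → IsZero a ⊎ IsZero b)

{-# OPTIONS --safe #-}
-- Summing the cone equations over all tuples j shows that the entries of an integer point
-- of C(N,d,k) add up to d^k times its common marginal, so every such total is a multiple
-- of d^k. The multiplicity vector of an OA with d^k runs has total exactly d^k; hence if it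
-- is a sum a + b of integer points of the cone, one of a, b has total 0 and vanishes.
module Submission where

open import Defs
open import Data.Bool.Base using (if_then_else_)
open import Data.Fin using (Fin; zero; suc; inject≤)
open import Data.Fin.Properties using (inject≤-injective) renaming (_≟_ to _≟ᶠ_)
open import Data.List using (List; []; _∷_; _++_; map; concatMap; filter; length; allFin)
open import Data.List.Properties using (map-cong; map-++; map-∘; map-tabulate; length-tabulate)
open import Data.Nat using (ℕ; zero; suc; _+_; _*_; _^_; _≤_; z≤n; s≤s)
open import Data.Nat.Divisibility using (_∣_; divides; ∣⇒≤)
open import Data.Nat.ListAction using (sum)
open import Data.Nat.ListAction.Properties using (sum-++)
open import Data.Nat.Properties
open import Algebra.Properties.CommutativeSemigroup +-commutativeSemigroup
  using () renaming (interchange to +-interchange)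
open import Data.Product using (_,_)
open import Data.Sum using (_⊎_; inj₁; inj₂) renaming (map to ⊎-map)
open import Data.Vec using ([]; _∷_; replicate)
open import Function using (_∘_)
open import Relation.Binary.Definitions using (DecidableEquality)
open import Relation.Binary.PropositionalEquality
open import Relation.Nullary using (Dec; yes; no; does; _×-dec_; ¬_)
open import Relation.Unary using (Decidable)

private
  variable
    X Y A B : Set
    N d k r : ℕ

∑ : List X → (X → ℕ) → ℕ
∑ L f = sum (map f L)

infix 5 ∑
syntax ∑ L (λ x → e) = ∑[ x ∈ L ] e

∑-cong : ∀ {f g : X → ℕ} (L : List X) → (∀ x → f x ≡ g x) → ∑ L f ≡ ∑ L g
∑-cong L f≗g = cong sum (map-cong f≗g L)

∑-zero : (L : List X) → ∑[ _ ∈ L ] 0 ≡ 0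
∑-zero []      = refl
∑-zero (_ ∷ L) = ∑-zero L

∑-const : (L : List X) (c : ℕ) → ∑[ _ ∈ L ] c ≡ length L * c
∑-const []      c = refl
∑-const (_ ∷ L) c = cong (c +_) (∑-const L c)

length-as-∑ : (L : List X) → length L ≡ ∑[ _ ∈ L ] 1
length-as-∑ []      = refl
length-as-∑ (_ ∷ L) = cong suc (length-as-∑ L)

∑-+ : (L : List X) (f g : X → ℕ) → ∑[ x ∈ L ] (f x + g x) ≡ ∑ L f + ∑ L g
∑-+ []      f g = refl
∑-+ (x ∷ L) f g =
  trans (cong (f x + g x +_) (∑-+ L f g)) (+-interchange (f x) (g x) (∑ L f) (∑ L g))

∑-*ˡ : (L : List X) (c : ℕ) (f : X → ℕ) → ∑[ x ∈ L ] (c * f x) ≡ c * ∑ L f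
∑-*ˡ []      c f = sym (*-zeroʳ c)
∑-*ˡ (x ∷ L) c f = trans (cong (c * f x +_) (∑-*ˡ L c f)) (sym (*-distribˡ-+ c (f x) (∑ L f)))

∑-*ʳ : (L : List X) (c : ℕ) (f : X → ℕ) → ∑[ x ∈ L ] (f x * c) ≡ ∑ L f * c
∑-*ʳ []      c f = refl
∑-*ʳ (x ∷ L) c f = trans (cong (f x * c +_) (∑-*ʳ L c f)) (sym (*-distribʳ-+ c (f x) (∑ L f)))

∑-swap : (L : List X) (M : List Y) (h : X → Y → ℕ) →
  ∑[ x ∈ L ] ∑[ y ∈ M ] h x y ≡ ∑[ y ∈ M ] ∑[ x ∈ L ] h x y
∑-swap []      M h = sym (∑-zero M)
∑-swap (x ∷ L) M h =
  trans (cong (∑ M (h x) +_) (∑-swap L M h)) (sym (∑-+ M (h x) (λ y → ∑[ x ∈ L ] h x y)))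

∑-mono-≤ : ∀ {f g : X → ℕ} (L : List X) → (∀ x → f x ≤ g x) → ∑ L f ≤ ∑ L g
∑-mono-≤ []      f≤g = z≤n
∑-mono-≤ (x ∷ L) f≤g = +-mono-≤ (f≤g x) (∑-mono-≤ L f≤g)

∑-++ : (L M : List X) (f : X → ℕ) → ∑ (L ++ M) f ≡ ∑ L f + ∑ M f
∑-++ L M f = trans (cong sum (map-++ f L M)) (sum-++ (map f L) (map f M))

∑-concatMap : (F : X → List Y) (L : List X) (f : Y → ℕ) →
  ∑ (concatMap F L) f ≡ ∑[ x ∈ L ] ∑ (F x) f
∑-concatMap F []      f = refl
∑-concatMap F (x ∷ L) f =
  trans (∑-++ (F x) (concatMap F L) f) (cong (∑ (F x) f +_) (∑-concatMap F L f))

∑-map : (g : X → Y) (L : List X) (f : Y → ℕ) → ∑ (map g L) f ≡ ∑ L (f ∘ g)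
∑-map g L f = cong sum (sym (map-∘ L))

∑-allFin-suc : (n : ℕ) (f : Fin (suc n) → ℕ) →
  ∑ (allFin (suc n)) f ≡ f zero + (∑[ i ∈ allFin n ] f (suc i))
∑-allFin-suc n f =
  cong (f zero +_) (cong sum (trans (map-tabulate suc f) (sym (map-tabulate (λ i → i) (f ∘ suc)))))

𝟙 : Dec A → ℕ
𝟙 a? = if does a? then 1 else 0

𝟙-× : (a? : Dec A) (b? : Dec B) → 𝟙 (a? ×-dec b?) ≡ 𝟙 a? * 𝟙 b?
𝟙-× (yes _) b? = sym (*-identityˡ (𝟙 b?))
𝟙-× (no _)  b? = refl

𝟙*n≤n : (a? : Dec A) (n : ℕ) → 𝟙 a? * n ≤ n
𝟙*n≤n (yes _) n = ≤-reflexive (*-identityˡ n)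
𝟙*n≤n (no _)  n = z≤n

module _ {P : X → Set} (P? : Decidable P) where

  ∑-filter : (L : List X) (f : X → ℕ) → ∑ (filter P? L) f ≡ ∑[ x ∈ L ] 𝟙 (P? x) * f x
  ∑-filter []      f = refl
  ∑-filter (x ∷ L) f with P? x
  ... | yes _ = cong₂ _+_ (sym (+-identityʳ (f x))) (∑-filter L f)
  ... | no _  = ∑-filter L f

  length-filter-as-∑ : (L : List X) → length (filter P? L) ≡ ∑[ x ∈ L ] 𝟙 (P? x)
  length-filter-as-∑ []      = refl
  length-filter-as-∑ (x ∷ L) with P? x
  ... | yes _ = cong suc (length-filter-as-∑ L)
  ... | no _  = length-filter-as-∑ L

Enumerates : DecidableEquality X → List X → Set
Enumerates _≟_ L = ∀ z → ∑[ y ∈ L ] 𝟙 (z ≟ y) ≡ 1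

module _ {_≟_ : DecidableEquality X} (L : List X) (enum : Enumerates _≟_ L) where

  ∑-δ : (z : X) (g : X → ℕ) → ∑[ y ∈ L ] 𝟙 (z ≟ y) * g y ≡ g z
  ∑-δ z g = begin
    ∑[ y ∈ L ] 𝟙 (z ≟ y) * g y    ≡⟨ ∑-cong L sift ⟩
    ∑[ y ∈ L ] 𝟙 (z ≟ y) * g z    ≡⟨ ∑-*ʳ L (g z) (λ y → 𝟙 (z ≟ y)) ⟩
    (∑[ y ∈ L ] 𝟙 (z ≟ y)) * g z  ≡⟨ cong (_* g z) (enum z) ⟩
    1 * g z                       ≡⟨ *-identityˡ (g z) ⟩
    g z                           ∎
    where
    open ≡-Reasoning
    sift : ∀ y → 𝟙 (z ≟ y) * g y ≡ 𝟙 (z ≟ y) * g z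
    sift y with z ≟ y
    ... | yes refl = refl
    ... | no _     = refl

allFin-enumerates : (n : ℕ) → Enumerates _≟ᶠ_ (allFin n)
allFin-enumerates (suc n) zero =
  trans (∑-allFin-suc n (λ y → 𝟙 (zero ≟ᶠ y))) (cong suc (∑-zero (allFin n)))
allFin-enumerates (suc n) (suc z) =
  trans (∑-allFin-suc n (λ y → 𝟙 (suc z ≟ᶠ y))) (allFin-enumerates n z)

∑-allPoints-suc : (N d : ℕ) (f : Point (suc N) d → ℕ) →
  ∑ (allPoints (suc N) d) f ≡ ∑[ a ∈ allFin d ] ∑[ x ∈ allPoints N d ] f (a ∷ x)
∑-allPoints-suc N d f =
  trans (∑-concatMap (λ a → map (a ∷_) (allPoints N d)) (allFin d) f)
        (∑-cong (allFin d) (λ a → ∑-map (a ∷_) (allPoints N d) f))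

allPoints-enumerates : (N d : ℕ) → Enumerates _≟ᵖ_ (allPoints N d)
allPoints-enumerates zero    d []       = refl
allPoints-enumerates (suc N) d (z ∷ zs) = begin
  ∑[ y ∈ allPoints (suc N) d ] 𝟙 ((z ∷ zs) ≟ᵖ y)                    ≡⟨ ∑-allPoints-suc N d _ ⟩
  ∑[ a ∈ allFin d ] ∑[ x ∈ allPoints N d ] 𝟙 ((z ∷ zs) ≟ᵖ (a ∷ x))  ≡⟨ ∑-cong (allFin d) factor ⟩
  ∑[ a ∈ allFin d ] 𝟙 (z ≟ᶠ a)                                     ≡⟨ allFin-enumerates d z ⟩
  1                                                                ∎
  where
  open ≡-Reasoning
  factor : ∀ a → ∑[ x ∈ allPoints N d ] 𝟙 ((z ∷ zs) ≟ᵖ (a ∷ x)) ≡ 𝟙 (z ≟ᶠ a)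
  factor a = begin
    ∑[ x ∈ allPoints N d ] 𝟙 ((z ∷ zs) ≟ᵖ (a ∷ x))     ≡⟨ ∑-cong (allPoints N d) (λ x → 𝟙-× (z ≟ᶠ a) (zs ≟ᵖ x)) ⟩
    ∑[ x ∈ allPoints N d ] 𝟙 (z ≟ᶠ a) * 𝟙 (zs ≟ᵖ x)    ≡⟨ ∑-*ˡ (allPoints N d) (𝟙 (z ≟ᶠ a)) _ ⟩
    𝟙 (z ≟ᶠ a) * (∑[ x ∈ allPoints N d ] 𝟙 (zs ≟ᵖ x))  ≡⟨ cong (𝟙 (z ≟ᶠ a) *_) (allPoints-enumerates N d zs) ⟩
    𝟙 (z ≟ᶠ a) * 1                                     ≡⟨ *-identityʳ (𝟙 (z ≟ᶠ a)) ⟩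
    𝟙 (z ≟ᶠ a)                                         ∎

∑-δ-allPoints : (z : Point N d) (g : Point N d → ℕ) → ∑[ y ∈ allPoints N d ] 𝟙 (z ≟ᵖ y) * g y ≡ g z
∑-δ-allPoints {N} {d} = ∑-δ {_≟_ = _≟ᵖ_} (allPoints N d) (allPoints-enumerates N d)

length-allPoints : (N d : ℕ) → length (allPoints N d) ≡ d ^ N
length-allPoints zero    d = refl
length-allPoints (suc N) d = begin
  length (allPoints (suc N) d)                ≡⟨ length-as-∑ (allPoints (suc N) d) ⟩
  ∑[ _ ∈ allPoints (suc N) d ] 1              ≡⟨ ∑-allPoints-suc N d (λ _ → 1) ⟩
  ∑[ _ ∈ allFin d ] ∑[ _ ∈ allPoints N d ] 1  ≡⟨ ∑-cong (allFin d) (λ _ → sym (length-as-∑ (allPoints N d))) ⟩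
  ∑[ _ ∈ allFin d ] length (allPoints N d)    ≡⟨ ∑-const (allFin d) (length (allPoints N d)) ⟩
  length (allFin d) * length (allPoints N d)  ≡⟨ cong₂ _*_ (length-tabulate {n = d} (λ i → i)) (length-allPoints N d) ⟩
  d * d ^ N                                   ∎
  where open ≡-Reasoning

total : IntVec N d → ℕ
total {N} {d} v = ∑ (allPoints N d) v

total≡0⇒IsZero : (v : IntVec N d) → total v ≡ 0 → IsZero v
total≡0⇒IsZero {N} {d} v total≡0 x = n≤0⇒n≡0 (begin
  v x                                      ≡⟨ ∑-δ-allPoints x v ⟨
  ∑[ y ∈ allPoints N d ] 𝟙 (x ≟ᵖ y) * v y  ≤⟨ ∑-mono-≤ (allPoints N d) (λ y → 𝟙*n≤n (x ≟ᵖ y) (v y)) ⟩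
  total v                                  ≡⟨ total≡0 ⟩
  0                                        ∎)
  where open ≤-Reasoning

IsZero⇒total≡0 : (v : IntVec N d) → IsZero v → total v ≡ 0
IsZero⇒total≡0 {N} {d} v v≡0 = trans (∑-cong (allPoints N d) v≡0) (∑-zero (allPoints N d))

marginal-as-∑ : (v : IntVec N d) (S : Columns k N) (j : Point k d) →
  marginal v S j ≡ ∑[ x ∈ allPoints N d ] 𝟙 (restrict x S ≟ᵖ j) * v x
marginal-as-∑ {N} {d} v S j = ∑-filter (λ x → restrict x S ≟ᵖ j) (allPoints N d) v

∑-marginal : (v : IntVec N d) (S : Columns k N) → ∑[ j ∈ allPoints k d ] marginal v S j ≡ total v
∑-marginal {N} {d} {k} v S = begin
  ∑[ j ∈ allPoints k d ] marginal v S j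
    ≡⟨ ∑-cong (allPoints k d) (marginal-as-∑ v S) ⟩
  ∑[ j ∈ allPoints k d ] ∑[ x ∈ allPoints N d ] 𝟙 (restrict x S ≟ᵖ j) * v x
    ≡⟨ ∑-swap (allPoints k d) (allPoints N d) _ ⟩
  ∑[ x ∈ allPoints N d ] ∑[ j ∈ allPoints k d ] 𝟙 (restrict x S ≟ᵖ j) * v x
    ≡⟨ ∑-cong (allPoints N d) (λ x → ∑-δ-allPoints (restrict x S) (λ _ → v x)) ⟩
  total v
    ∎
  where open ≡-Reasoning

total-inCone : (v : IntVec N d) → InCone N d k v → (S : Columns k N) (j : Point k d) →
  total v ≡ d ^ k * marginal v S j
total-inCone {N} {d} {k} v v∈C S j = begin
  total v                                  ≡⟨ ∑-marginal v S ⟨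
  ∑[ j′ ∈ allPoints k d ] marginal v S j′  ≡⟨ ∑-cong (allPoints k d) (λ j′ → v∈C S j′ j) ⟩
  ∑[ _ ∈ allPoints k d ] marginal v S j    ≡⟨ ∑-const (allPoints k d) (marginal v S j) ⟩
  length (allPoints k d) * marginal v S j  ≡⟨ cong (_* marginal v S j) (length-allPoints k d) ⟩
  d ^ k * marginal v S j                   ∎
  where open ≡-Reasoning

d^k∣total : (v : IntVec N d) → InCone N d k v → Columns k N → Point k d → d ^ k ∣ total v
d^k∣total {d = d} {k} v v∈C S j =
  divides (marginal v S j) (trans (total-inCone v v∈C S j) (*-comm (d ^ k) (marginal v S j)))

multiplicity-as-∑ : (A : Array r N d) (x : Point N d) →
  multiplicity A x ≡ ∑[ a ∈ allFin r ] 𝟙 (A a ≟ᵖ x)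
multiplicity-as-∑ {r} A x = length-filter-as-∑ (λ a → A a ≟ᵖ x) (allFin r)

total-multiplicity : (A : Array r N d) → total (multiplicity A) ≡ r
total-multiplicity {r} {N} {d} A = begin
  ∑[ x ∈ allPoints N d ] multiplicity A x                ≡⟨ ∑-cong (allPoints N d) (multiplicity-as-∑ A) ⟩
  ∑[ x ∈ allPoints N d ] ∑[ a ∈ allFin r ] 𝟙 (A a ≟ᵖ x)  ≡⟨ ∑-swap (allPoints N d) (allFin r) _ ⟩
  ∑[ a ∈ allFin r ] ∑[ x ∈ allPoints N d ] 𝟙 (A a ≟ᵖ x)  ≡⟨ ∑-cong (allFin r) (λ a → allPoints-enumerates N d (A a)) ⟩
  ∑[ _ ∈ allFin r ] 1                                    ≡⟨ length-as-∑ (allFin r) ⟨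
  length (allFin r)                                      ≡⟨ length-tabulate {n = r} (λ i → i) ⟩
  r                                                      ∎
  where open ≡-Reasoning

marginal-multiplicity : (A : Array r N d) (S : Columns k N) (j : Point k d) →
  marginal (multiplicity A) S j ≡ countRows A S j
marginal-multiplicity {r} {N} {d} A S j = begin
  marginal (multiplicity A) S j
    ≡⟨ marginal-as-∑ (multiplicity A) S j ⟩
  ∑[ x ∈ allPoints N d ] 𝟙 (inFibre x) * multiplicity A x
    ≡⟨ ∑-cong (allPoints N d) expand ⟩
  ∑[ x ∈ allPoints N d ] ∑[ a ∈ allFin r ] 𝟙 (A a ≟ᵖ x) * 𝟙 (inFibre x)
    ≡⟨ ∑-swap (allPoints N d) (allFin r) _ ⟩
  ∑[ a ∈ allFin r ] ∑[ x ∈ allPoints N d ] 𝟙 (A a ≟ᵖ x) * 𝟙 (inFibre x)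
    ≡⟨ ∑-cong (allFin r) (λ a → ∑-δ-allPoints (A a) (𝟙 ∘ inFibre)) ⟩
  ∑[ a ∈ allFin r ] 𝟙 (inFibre (A a))
    ≡⟨ length-filter-as-∑ (inFibre ∘ A) (allFin r) ⟨
  countRows A S j
    ∎
  where
  open ≡-Reasoning
  inFibre : (x : Point N d) → Dec (restrict x S ≡ j)
  inFibre x = restrict x S ≟ᵖ j
  expand : ∀ x → 𝟙 (inFibre x) * multiplicity A x ≡ ∑[ a ∈ allFin r ] 𝟙 (A a ≟ᵖ x) * 𝟙 (inFibre x)
  expand x = begin
    𝟙 (inFibre x) * multiplicity A x                   ≡⟨ *-comm (𝟙 (inFibre x)) (multiplicity A x) ⟩
    multiplicity A x * 𝟙 (inFibre x)                   ≡⟨ cong (_* 𝟙 (inFibre x)) (multiplicity-as-∑ A x) ⟩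
    (∑[ a ∈ allFin r ] 𝟙 (A a ≟ᵖ x)) * 𝟙 (inFibre x)   ≡⟨ ∑-*ʳ (allFin r) (𝟙 (inFibre x)) (λ a → 𝟙 (A a ≟ᵖ x)) ⟨
    ∑[ a ∈ allFin r ] 𝟙 (A a ≟ᵖ x) * 𝟙 (inFibre x)     ∎

multiplicity-inCone : (A : Array r N d) → IsOA r N d k A → InCone N d k (multiplicity A)
multiplicity-inCone A isOA S j j′ = begin
  marginal (multiplicity A) S j   ≡⟨ marginal-multiplicity A S j ⟩
  countRows A S j                 ≡⟨ isOA S j j′ ⟩
  countRows A S j′                ≡⟨ marginal-multiplicity A S j′ ⟨
  marginal (multiplicity A) S j′  ∎
  where open ≡-Reasoning

firstColumns : k ≤ N → Columns k N
firstColumns k≤N = (λ i → inject≤ i k≤N) , λ {i} {j} → inject≤-injective k≤N k≤N i j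

m∣a⇒a+b≡m⇒a≡0⊎b≡0 : ∀ {m a b} → m ∣ a → a + b ≡ m → a ≡ 0 ⊎ b ≡ 0
m∣a⇒a+b≡m⇒a≡0⊎b≡0 {a = zero}          _   _     = inj₁ refl
m∣a⇒a+b≡m⇒a≡0⊎b≡0 {m} {a = suc a} {b} m∣a a+b≡m = inj₂ (n≤0⇒n≡0 (+-cancelˡ-≤ (suc a) b 0 (begin
  suc a + b  ≡⟨ a+b≡m ⟩
  m          ≤⟨ ∣⇒≤ m∣a ⟩
  suc a      ≡⟨ +-identityʳ (suc a) ⟨
  suc a + 0  ∎)))
  where open ≤-Reasoning

total≡d^k⇒InHilbertBasis : ∀ {c} → k ≤ N → 1 ≤ d → InCone N d k c → total c ≡ d ^ k →
  InHilbertBasis N d k c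
total≡d^k⇒InHilbertBasis {k} {N} {d@(suc _)} {c} k≤N (s≤s z≤n) c∈C total≡d^k =
  c∈C , nonzero , indecomposable
  where
  nonzero : ¬ IsZero c
  nonzero c≡0 = <⇒≢ (m^n>0 d k) (trans (sym (IsZero⇒total≡0 c c≡0)) total≡d^k)
  indecomposable : (a b : IntVec N d) → InCone N d k a → InCone N d k b →
    (∀ x → c x ≡ a x + b x) → IsZero a ⊎ IsZero b
  indecomposable a b a∈C _ c≡a+b =
    ⊎-map (total≡0⇒IsZero a) (total≡0⇒IsZero b)
      (m∣a⇒a+b≡m⇒a≡0⊎b≡0 (d^k∣total a a∈C (firstColumns k≤N) (replicate k zero)) (begin
        total a + total b                   ≡⟨ ∑-+ (allPoints N d) a b ⟨
        ∑[ x ∈ allPoints N d ] (a x + b x)  ≡⟨ ∑-cong (allPoints N d) c≡a+b ⟨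
        total c                             ≡⟨ total≡d^k ⟩
        d ^ k                               ∎))
    where open ≡-Reasoning

-- Irredundancy (the MDS property) is not needed: index one alone makes the total minimal.
proposition7 : (N d k : ℕ) → 1 ≤ N → 2 ≤ d → 1 ≤ k → k ≤ N →
    (A : Array (d ^ k) N d) → IsIrOA N d k A →
    InHilbertBasis N d k (multiplicity A)
proposition7 N d k _ 2≤d _ k≤N A (isOA , _) =
  total≡d^k⇒InHilbertBasis k≤N (<⇒≤ 2≤d) (multiplicity-inCone A isOA) (total-multiplicity A)
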